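{- The reduction relation $\to_j$ is confluent and terminating. Moreover, writing $j(t)$ for the unique $j$-normal form of $t$, one has $j(x)=x$, $j(\lambda x.u)=\lambda x.j(u)$, $j(u\,v)=j(u)\,j(v)$ and $j(u[x/v])=j(u)\{x/j(v)\}$.
   Context: $\lambda j$-terms: $t,u ::= x \mid \lambda x.t \mid t\,u \mid t[x/u]$; $[x/u]$ is a jump, $\lambda x.t$ and $t[x/u]$ bind $x$ in $t$ (not in $u$), terms modulo $\alpha$-conversion. $|t|_x$ is the number of free occurrences of $x$ in $t$, $t\{x/u\}$ capture-avoiding substitution. When $|t|_x\ge2$, $t_{[y]_x}$ is any term obtained by renaming $i$ free occurrences of $x$ into a fresh $y$, $1\le i\le|t|_x-1$. $\to_j$ is the contextual closure of the rules (w) $t[x/u]\mapsto t$ if $|t|_x=0$; (d) $t[x/u]\mapsto t\{x/u\}$ if $|t|_x=1$; (c) $t[x/u]\mapsto t_{[y]_x}[x/u][y/u]$ if $|t|_x>1$, $y$ fresh. -}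

module Defs where

open import Data.Nat using (ℕ; zero; suc; _+_; _<_; _≤_)
open import Data.Fin using (Fin; zero; suc)
open import Data.Fin.Properties using (_≟_)
open import Relation.Nullary using (¬_; yes; no)
open import Relation.Binary.PropositionalEquality using (_≡_)
open import Relation.Binary.Construct.Closure.ReflexiveTransitive using (Star)
open import Data.Product using (_×_)

-- λj-terms, well-scoped de Bruijn representation (terms modulo α).
-- Term n : terms with at most n free variables (indices Fin n).
-- lam t binds index 0 in t;  t [ u ] is t[x/u], binding index 0 in t (not in u).
data Term (n : ℕ) : Set where
  var  : Fin n → Term n
  lam  : Term (suc n) → Term n
  app  : Term n → Term n → Term n
  _[_] : Term (suc n) → Term n → Term n

ext : ∀ {a b} → (Fin a → Fin b) → Fin (suc a) → Fin (suc b)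
ext ρ zero    = zero
ext ρ (suc i) = suc (ρ i)

rename : ∀ {a b} → (Fin a → Fin b) → Term a → Term b
rename ρ (var i)   = var (ρ i)
rename ρ (lam t)   = lam (rename (ext ρ) t)
rename ρ (app t u) = app (rename ρ t) (rename ρ u)
rename ρ (t [ u ]) = rename (ext ρ) t [ rename ρ u ]

weaken : ∀ {n} → Term n → Term (suc n)
weaken = rename suc

exts : ∀ {a b} → (Fin a → Term b) → Fin (suc a) → Term (suc b)
exts σ zero    = var zero
exts σ (suc i) = weaken (σ i)

subst : ∀ {a b} → (Fin a → Term b) → Term a → Term b
subst σ (var i)   = σ i
subst σ (lam t)   = lam (subst (exts σ) t)
subst σ (app t u) = app (subst σ t) (subst σ u)
subst σ (t [ u ]) = subst (exts σ) t [ subst σ u ]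

-- single substitution  t{x/u}  where x is index 0 of t
sub0 : ∀ {n} → Term n → Fin (suc n) → Term n
sub0 u zero    = u
sub0 u (suc i) = var i

_⟨_⟩ : ∀ {n} → Term (suc n) → Term n → Term n
t ⟨ u ⟩ = subst (sub0 u) t

occ : ∀ {n} → Fin n → Term n → ℕ
occ i (var j) with i ≟ j
... | yes _ = 1
... | no  _ = 0
occ i (lam t)   = occ (suc i) t
occ i (app t u) = occ i t + occ i u
occ i (t [ u ]) = occ (suc i) t + occ i u

-- Renaming some occurrences of x into a fresh y.
-- In Term (suc n), x is index 0; in the result (Term (suc (suc n))),
-- index 0 is x and index 1 is the fresh y, other variables are shifted by one.
data SplitVar {n : ℕ} : Fin (suc n) → Fin (suc (suc n)) → Set where
  keep : SplitVar zero zero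
  move : SplitVar zero (suc zero)
  other : (k : Fin n) → SplitVar (suc k) (suc (suc k))

data LiftR {a b : ℕ} (R : Fin a → Fin b → Set) : Fin (suc a) → Fin (suc b) → Set where
  here  : LiftR R zero zero
  there : ∀ {i j} → R i j → LiftR R (suc i) (suc j)

data RelT : {a b : ℕ} → (Fin a → Fin b → Set) → Term a → Term b → Set₁ where
  var : ∀ {a b} {R : Fin a → Fin b → Set} {i j} → R i j → RelT R (var i) (var j)
  lam : ∀ {a b} {R : Fin a → Fin b → Set} {t t'} →
        RelT (LiftR R) t t' → RelT R (lam t) (lam t')
  app : ∀ {a b} {R : Fin a → Fin b → Set} {t t' u u'} →
        RelT R t t' → RelT R u u' → RelT R (app t u) (app t' u')
  jmp : ∀ {a b} {R : Fin a → Fin b → Set} {t t' u u'} →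
        RelT (LiftR R) t t' → RelT R u u' → RelT R (t [ u ]) (t' [ u' ])

-- t' is a t_[y]_x : obtained by renaming i occurrences of x (index 0) into y
-- (index 1), with 1 ≤ i ≤ |t|_x - 1 (i.e. at least one occurrence moved and
-- at least one kept).
IsSplit : ∀ {n} → Term (suc n) → Term (suc (suc n)) → Set₁
IsSplit t t' = RelT SplitVar t t' × (1 ≤ occ zero t') × (1 ≤ occ (suc zero) t')

data _↦_ {n : ℕ} : Term n → Term n → Set₁ where
  w : ∀ {t u} → occ zero t ≡ 0 → (t [ u ]) ↦ (t ⟨ u ⟩)
  d : ∀ {t u} → occ zero t ≡ 1 → (t [ u ]) ↦ (t ⟨ u ⟩)
  c : ∀ {t u} t' → 1 < occ zero t → IsSplit t t' →
      (t [ u ]) ↦ ((t' [ weaken u ]) [ u ])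

data _⟶_ {n : ℕ} : Term n → Term n → Set₁ where
  root : ∀ {t s} → t ↦ s → t ⟶ s
  lamC : ∀ {t s} → t ⟶ s → lam t ⟶ lam s
  appL : ∀ {t s u} → t ⟶ s → app t u ⟶ app s u
  appR : ∀ {t s u} → t ⟶ s → app u t ⟶ app u s
  jmpL : ∀ {t s u} → t ⟶ s → (t [ u ]) ⟶ (s [ u ])
  jmpR : ∀ {t s u} → t ⟶ s → (u [ t ]) ⟶ (u [ s ])

_⟶*_ : ∀ {n} → Term n → Term n → Set₁
_⟶*_ = Star _⟶_

Normal : ∀ {n} → Term n → Set₁
Normal t = ∀ s → ¬ (t ⟶ s)

IsNF : ∀ {n} → Term n → Term n → Set₁
IsNF t s = (t ⟶* s) × Normal s

-- Let jnf eliminate all jumps, jnf (t [ u ]) = jnf t ⟨ jnf u ⟩.  It is invariant under every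
-- step (for rule c because identifying y with x again undoes the split t_[y]_x), and its values
-- are the jump-free terms, which are exactly the normal forms since every jump is a redex.
-- Hence once every term is known to reach some normal form, every reduct of t reduces to jnf t:
-- this gives confluence, uniqueness of normal forms and the four equations at once.
--
-- For termination, μ (t [ u ]) = μ t + 3 ^ K * (μ u + 1), where K = weight₀ t counts the
-- occurrences of x in t, each one lying in the argument of an inner jump s [ v ] counted
-- 3 ^ (K of s) times.  Rules w and d trade this summand for K * μ u; rule c splits K into a + b
-- with a, b ≥ 1, and 3 ^ a + 3 ^ b < 3 ^ (a + b).

module Submission where

open import Defs
open import Data.Nat using (ℕ; zero; suc; _+_; _*_; _^_; _≤_; _<_; z≤n; s≤s; s≤s⁻¹)
open import Data.Nat.Properties hiding (_≟_)
open import Data.Nat.Induction using (<-wellFounded)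
open import Data.Nat.Tactic.RingSolver using (solve-∀)
open import Data.Fin using (Fin; zero; suc)
open import Data.Fin.Properties using (_≟_)
open import Data.Vec.Functional using (_∷_)
open import Data.Product using (Σ; ∃; _×_; _,_)
open import Data.Sum using (_⊎_; inj₁; inj₂)
open import Data.Empty using (⊥-elim)
open import Function using (_∘_; flip)
open import Relation.Nullary using (yes; no)
open import Relation.Binary.PropositionalEquality
  using (_≡_; refl; sym; trans; cong; cong₂; module ≡-Reasoning)
  renaming (subst to subst≡)
open import Relation.Binary.Construct.Closure.ReflexiveTransitive using (ε; _◅_)
open import Induction.WellFounded using (WellFounded; Acc; acc; module Subrelation)
import Relation.Binary.Construct.On as On

private
  variable
    l m n : ℕ

-- Substitution

ext-cong : {ρ ρ' : Fin m → Fin n} → (∀ i → ρ i ≡ ρ' i) → ∀ i → ext ρ i ≡ ext ρ' i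
ext-cong e zero    = refl
ext-cong e (suc i) = cong suc (e i)

rename-cong : {ρ ρ' : Fin m → Fin n} → (∀ i → ρ i ≡ ρ' i) → ∀ t → rename ρ t ≡ rename ρ' t
rename-cong e (var i)   = cong var (e i)
rename-cong e (lam t)   = cong lam (rename-cong (ext-cong e) t)
rename-cong e (app t u) = cong₂ app (rename-cong e t) (rename-cong e u)
rename-cong e (t [ u ]) = cong₂ _[_] (rename-cong (ext-cong e) t) (rename-cong e u)

exts-cong : {σ σ' : Fin m → Term n} → (∀ i → σ i ≡ σ' i) → ∀ i → exts σ i ≡ exts σ' i
exts-cong e zero    = refl
exts-cong e (suc i) = cong weaken (e i)

subst-cong : {σ σ' : Fin m → Term n} → (∀ i → σ i ≡ σ' i) → ∀ t → subst σ t ≡ subst σ' t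
subst-cong e (var i)   = e i
subst-cong e (lam t)   = cong lam (subst-cong (exts-cong e) t)
subst-cong e (app t u) = cong₂ app (subst-cong e t) (subst-cong e u)
subst-cong e (t [ u ]) = cong₂ _[_] (subst-cong (exts-cong e) t) (subst-cong e u)

ext-∘ : (ρ : Fin m → Fin n) (ρ' : Fin l → Fin m) → ∀ i → ext ρ (ext ρ' i) ≡ ext (ρ ∘ ρ') i
ext-∘ ρ ρ' zero    = refl
ext-∘ ρ ρ' (suc i) = refl

rename-rename : (ρ : Fin m → Fin n) (ρ' : Fin l → Fin m) → ∀ t →
                rename ρ (rename ρ' t) ≡ rename (ρ ∘ ρ') t
rename-rename ρ ρ' (var i)   = refl
rename-rename ρ ρ' (lam t)   =
  cong lam (trans (rename-rename (ext ρ) (ext ρ') t) (rename-cong (ext-∘ ρ ρ') t))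
rename-rename ρ ρ' (app t u) = cong₂ app (rename-rename ρ ρ' t) (rename-rename ρ ρ' u)
rename-rename ρ ρ' (t [ u ]) =
  cong₂ _[_] (trans (rename-rename (ext ρ) (ext ρ') t) (rename-cong (ext-∘ ρ ρ') t))
             (rename-rename ρ ρ' u)

exts-ext : (σ : Fin m → Term n) (ρ : Fin l → Fin m) → ∀ i → exts σ (ext ρ i) ≡ exts (σ ∘ ρ) i
exts-ext σ ρ zero    = refl
exts-ext σ ρ (suc i) = refl

subst-rename : (σ : Fin m → Term n) (ρ : Fin l → Fin m) → ∀ t →
               subst σ (rename ρ t) ≡ subst (σ ∘ ρ) t
subst-rename σ ρ (var i)   = refl
subst-rename σ ρ (lam t)   =
  cong lam (trans (subst-rename (exts σ) (ext ρ) t) (subst-cong (exts-ext σ ρ) t))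
subst-rename σ ρ (app t u) = cong₂ app (subst-rename σ ρ t) (subst-rename σ ρ u)
subst-rename σ ρ (t [ u ]) =
  cong₂ _[_] (trans (subst-rename (exts σ) (ext ρ) t) (subst-cong (exts-ext σ ρ) t))
             (subst-rename σ ρ u)

rename-exts : (ρ : Fin m → Fin n) (σ : Fin l → Term m) → ∀ i →
              rename (ext ρ) (exts σ i) ≡ exts (rename ρ ∘ σ) i
rename-exts ρ σ zero    = refl
rename-exts ρ σ (suc i) = trans (rename-rename (ext ρ) suc (σ i)) (sym (rename-rename suc ρ (σ i)))

rename-subst : (ρ : Fin m → Fin n) (σ : Fin l → Term m) → ∀ t →
               rename ρ (subst σ t) ≡ subst (rename ρ ∘ σ) t
rename-subst ρ σ (var i)   = refl
rename-subst ρ σ (lam t)   =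
  cong lam (trans (rename-subst (ext ρ) (exts σ) t) (subst-cong (rename-exts ρ σ) t))
rename-subst ρ σ (app t u) = cong₂ app (rename-subst ρ σ t) (rename-subst ρ σ u)
rename-subst ρ σ (t [ u ]) =
  cong₂ _[_] (trans (rename-subst (ext ρ) (exts σ) t) (subst-cong (rename-exts ρ σ) t))
             (rename-subst ρ σ u)

subst-exts : (σ : Fin m → Term n) (τ : Fin l → Term m) → ∀ i →
             subst (exts σ) (exts τ i) ≡ exts (subst σ ∘ τ) i
subst-exts σ τ zero    = refl
subst-exts σ τ (suc i) = trans (subst-rename (exts σ) suc (τ i)) (sym (rename-subst suc σ (τ i)))

subst-subst : (σ : Fin m → Term n) (τ : Fin l → Term m) → ∀ t →
              subst σ (subst τ t) ≡ subst (subst σ ∘ τ) t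
subst-subst σ τ (var i)   = refl
subst-subst σ τ (lam t)   =
  cong lam (trans (subst-subst (exts σ) (exts τ) t) (subst-cong (subst-exts σ τ) t))
subst-subst σ τ (app t u) = cong₂ app (subst-subst σ τ t) (subst-subst σ τ u)
subst-subst σ τ (t [ u ]) =
  cong₂ _[_] (trans (subst-subst (exts σ) (exts τ) t) (subst-cong (subst-exts σ τ) t))
             (subst-subst σ τ u)

exts-var : ∀ i → exts {m} var i ≡ var i
exts-var zero    = refl
exts-var (suc i) = refl

subst-var : (t : Term n) → subst var t ≡ t
subst-var (var i)   = refl
subst-var (lam t)   = cong lam (trans (subst-cong exts-var t) (subst-var t))
subst-var (app t u) = cong₂ app (subst-var t) (subst-var u)
subst-var (t [ u ]) = cong₂ _[_] (trans (subst-cong exts-var t) (subst-var t)) (subst-var u)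

weaken-⟨⟩ : (s r : Term n) → weaken s ⟨ r ⟩ ≡ s
weaken-⟨⟩ s r = trans (subst-rename (sub0 r) suc s) (subst-var s)

subst-⟨⟩ : (σ : Fin m → Term n) (t : Term (suc m)) (u : Term m) →
           subst σ (t ⟨ u ⟩) ≡ subst (exts σ) t ⟨ subst σ u ⟩
subst-⟨⟩ σ t u = begin
  subst σ (t ⟨ u ⟩)                                  ≡⟨ subst-subst σ (sub0 u) t ⟩
  subst (subst σ ∘ sub0 u) t                          ≡⟨ subst-cong pointwise t ⟩
  subst (subst (sub0 (subst σ u)) ∘ exts σ) t         ≡⟨ subst-subst (sub0 (subst σ u)) (exts σ) t ⟨
  subst (exts σ) t ⟨ subst σ u ⟩                      ∎
  where
  open ≡-Reasoning
  pointwise : ∀ i → subst σ (sub0 u i) ≡ subst (sub0 (subst σ u)) (exts σ i)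
  pointwise zero    = refl
  pointwise (suc i) = sym (weaken-⟨⟩ (σ i) (subst σ u))

rename-⟨⟩ : (ρ : Fin m → Fin n) (t : Term (suc m)) (u : Term m) →
            rename ρ (t ⟨ u ⟩) ≡ rename (ext ρ) t ⟨ rename ρ u ⟩
rename-⟨⟩ ρ t u = begin
  rename ρ (t ⟨ u ⟩)                           ≡⟨ rename-subst ρ (sub0 u) t ⟩
  subst (rename ρ ∘ sub0 u) t                  ≡⟨ subst-cong pointwise t ⟩
  subst (sub0 (rename ρ u) ∘ ext ρ) t          ≡⟨ subst-rename (sub0 (rename ρ u)) (ext ρ) t ⟨
  rename (ext ρ) t ⟨ rename ρ u ⟩              ∎
  where
  open ≡-Reasoning
  pointwise : ∀ i → rename ρ (sub0 u i) ≡ sub0 (rename ρ u) (ext ρ i)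
  pointwise zero    = refl
  pointwise (suc i) = refl

-- Jump elimination

LiftR⇒≡ext : {R : Fin m → Fin n → Set} {ρ : Fin n → Fin m} →
             (∀ {i j} → R i j → i ≡ ρ j) → ∀ {i j} → LiftR R i j → i ≡ ext ρ j
LiftR⇒≡ext h here      = refl
LiftR⇒≡ext h (there r) = cong suc (h r)

RelT⇒≡rename : {R : Fin m → Fin n → Set} {ρ : Fin n → Fin m} →
               (∀ {i j} → R i j → i ≡ ρ j) → ∀ {t t'} → RelT R t t' → t ≡ rename ρ t'
RelT⇒≡rename h (var r)    = cong var (h r)
RelT⇒≡rename h (lam r)    = cong lam (RelT⇒≡rename (LiftR⇒≡ext h) r)
RelT⇒≡rename h (app r r') = cong₂ app (RelT⇒≡rename h r) (RelT⇒≡rename h r')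
RelT⇒≡rename h (jmp r r') = cong₂ _[_] (RelT⇒≡rename (LiftR⇒≡ext h) r) (RelT⇒≡rename h r')

merge₀₁ : Fin (suc (suc n)) → Fin (suc n)
merge₀₁ zero    = zero
merge₀₁ (suc j) = j

IsSplit⇒≡rename : {t : Term (suc n)} {t' : Term (suc (suc n))} →
                  IsSplit t t' → t ≡ rename merge₀₁ t'
IsSplit⇒≡rename (rel , _) = RelT⇒≡rename (λ { keep → refl ; move → refl ; (other k) → refl }) rel

rename-merge₀₁-⟨⟩ : (s : Term (suc (suc n))) (r : Term n) →
                    rename merge₀₁ s ⟨ r ⟩ ≡ (s ⟨ weaken r ⟩) ⟨ r ⟩
rename-merge₀₁-⟨⟩ s r = begin
  rename merge₀₁ s ⟨ r ⟩                              ≡⟨ subst-rename (sub0 r) merge₀₁ s ⟩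
  subst (sub0 r ∘ merge₀₁) s                          ≡⟨ subst-cong pointwise s ⟩
  subst (subst (sub0 r) ∘ sub0 (weaken r)) s          ≡⟨ subst-subst (sub0 r) (sub0 (weaken r)) s ⟨
  (s ⟨ weaken r ⟩) ⟨ r ⟩                              ∎
  where
  open ≡-Reasoning
  pointwise : ∀ i → sub0 r (merge₀₁ i) ≡ subst (sub0 r) (sub0 (weaken r) i)
  pointwise zero          = sym (weaken-⟨⟩ r r)
  pointwise (suc zero)    = refl
  pointwise (suc (suc k)) = refl

jnf : Term n → Term n
jnf (var i)   = var i
jnf (lam t)   = lam (jnf t)
jnf (app t u) = app (jnf t) (jnf u)
jnf (t [ u ]) = jnf t ⟨ jnf u ⟩

jnf-rename : (ρ : Fin m → Fin n) (t : Term m) → jnf (rename ρ t) ≡ rename ρ (jnf t)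
jnf-rename ρ (var i)   = refl
jnf-rename ρ (lam t)   = cong lam (jnf-rename (ext ρ) t)
jnf-rename ρ (app t u) = cong₂ app (jnf-rename ρ t) (jnf-rename ρ u)
jnf-rename ρ (t [ u ]) =
  trans (cong₂ _⟨_⟩ (jnf-rename (ext ρ) t) (jnf-rename ρ u)) (sym (rename-⟨⟩ ρ (jnf t) (jnf u)))

jnf-exts : (σ : Fin m → Term n) → ∀ i → jnf (exts σ i) ≡ exts (jnf ∘ σ) i
jnf-exts σ zero    = refl
jnf-exts σ (suc i) = jnf-rename suc (σ i)

jnf-subst : (σ : Fin m → Term n) (t : Term m) → jnf (subst σ t) ≡ subst (jnf ∘ σ) (jnf t)
jnf-subst σ (var i)   = refl
jnf-subst σ (lam t)   = cong lam (trans (jnf-subst (exts σ) t) (subst-cong (jnf-exts σ) (jnf t)))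
jnf-subst σ (app t u) = cong₂ app (jnf-subst σ t) (jnf-subst σ u)
jnf-subst σ (t [ u ]) =
  trans (cong₂ _⟨_⟩ (trans (jnf-subst (exts σ) t) (subst-cong (jnf-exts σ) (jnf t))) (jnf-subst σ u))
        (sym (subst-⟨⟩ (jnf ∘ σ) (jnf t) (jnf u)))

jnf-⟨⟩ : (t : Term (suc n)) (u : Term n) → jnf (t ⟨ u ⟩) ≡ jnf t ⟨ jnf u ⟩
jnf-⟨⟩ t u = trans (jnf-subst (sub0 u) t) (subst-cong (λ { zero → refl ; (suc i) → refl }) (jnf t))

jnf-↦ : {t s : Term n} → t ↦ s → jnf t ≡ jnf s
jnf-↦ {t = t [ u ]} (w _) = sym (jnf-⟨⟩ t u)
jnf-↦ {t = t [ u ]} (d _) = sym (jnf-⟨⟩ t u)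
jnf-↦ (c {t} {u} t' _ split) = begin
  jnf t ⟨ jnf u ⟩
    ≡⟨ cong (λ s → jnf s ⟨ jnf u ⟩) (IsSplit⇒≡rename split) ⟩
  jnf (rename merge₀₁ t') ⟨ jnf u ⟩
    ≡⟨ cong _⟨ jnf u ⟩ (jnf-rename merge₀₁ t') ⟩
  rename merge₀₁ (jnf t') ⟨ jnf u ⟩
    ≡⟨ rename-merge₀₁-⟨⟩ (jnf t') (jnf u) ⟩
  (jnf t' ⟨ weaken (jnf u) ⟩) ⟨ jnf u ⟩
    ≡⟨ cong (λ r → (jnf t' ⟨ r ⟩) ⟨ jnf u ⟩) (jnf-rename suc u) ⟨
  (jnf t' ⟨ jnf (weaken u) ⟩) ⟨ jnf u ⟩
    ∎
  where open ≡-Reasoning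

jnf-⟶ : {t s : Term n} → t ⟶ s → jnf t ≡ jnf s
jnf-⟶ (root r) = jnf-↦ r
jnf-⟶ (lamC r) = cong lam (jnf-⟶ r)
jnf-⟶ (appL r) = cong₂ app (jnf-⟶ r) refl
jnf-⟶ (appR r) = cong₂ app refl (jnf-⟶ r)
jnf-⟶ (jmpL {u = u} r) = cong _⟨ jnf u ⟩ (jnf-⟶ r)
jnf-⟶ (jmpR {u = t} r) = cong (jnf t ⟨_⟩) (jnf-⟶ r)

jnf-⟶* : {t s : Term n} → t ⟶* s → jnf t ≡ jnf s
jnf-⟶* ε        = refl
jnf-⟶* (r ◅ rs) = trans (jnf-⟶ r) (jnf-⟶* rs)

data JumpFree {n} : Term n → Set where
  var : ∀ i → JumpFree (var i)
  lam : ∀ {t} → JumpFree t → JumpFree (lam t)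
  app : ∀ {t u} → JumpFree t → JumpFree u → JumpFree (app t u)

JumpFree-rename : (ρ : Fin m → Fin n) {t : Term m} → JumpFree t → JumpFree (rename ρ t)
JumpFree-rename ρ (var i)   = var (ρ i)
JumpFree-rename ρ (lam t)   = lam (JumpFree-rename (ext ρ) t)
JumpFree-rename ρ (app t u) = app (JumpFree-rename ρ t) (JumpFree-rename ρ u)

JumpFree-subst : {σ : Fin m → Term n} → (∀ i → JumpFree (σ i)) →
                 {t : Term m} → JumpFree t → JumpFree (subst σ t)
JumpFree-subst jσ (var i)   = jσ i
JumpFree-subst jσ (lam t)   =
  lam (JumpFree-subst (λ { zero → var zero ; (suc i) → JumpFree-rename suc (jσ i) }) t)
JumpFree-subst jσ (app t u) = app (JumpFree-subst jσ t) (JumpFree-subst jσ u)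

JumpFree-⟨⟩ : {t : Term (suc n)} {u : Term n} → JumpFree t → JumpFree u → JumpFree (t ⟨ u ⟩)
JumpFree-⟨⟩ jt ju = JumpFree-subst (λ { zero → ju ; (suc i) → var i }) jt

JumpFree-jnf : (t : Term n) → JumpFree (jnf t)
JumpFree-jnf (var i)   = var i
JumpFree-jnf (lam t)   = lam (JumpFree-jnf t)
JumpFree-jnf (app t u) = app (JumpFree-jnf t) (JumpFree-jnf u)
JumpFree-jnf (t [ u ]) = JumpFree-⟨⟩ (JumpFree-jnf t) (JumpFree-jnf u)

jnf-JumpFree : {t : Term n} → JumpFree t → jnf t ≡ t
jnf-JumpFree (var i)   = refl
jnf-JumpFree (lam t)   = cong lam (jnf-JumpFree t)
jnf-JumpFree (app t u) = cong₂ app (jnf-JumpFree t) (jnf-JumpFree u)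

JumpFree⇒Normal : {t : Term n} → JumpFree t → Normal t
JumpFree⇒Normal (lam t)   _ (lamC r) = JumpFree⇒Normal t _ r
JumpFree⇒Normal (app t u) _ (appL r) = JumpFree⇒Normal t _ r
JumpFree⇒Normal (app t u) _ (appR r) = JumpFree⇒Normal u _ r
JumpFree⇒Normal (var i)   _ (root ())
JumpFree⇒Normal (lam t)   _ (root ())
JumpFree⇒Normal (app t u) _ (root ())

-- Every jump is a redex

occ-suc : (i j : Fin n) → occ (suc i) (var (suc j)) ≡ occ i (var j)
occ-suc i j with i ≟ j
... | yes _ = refl
... | no  _ = refl

occ-var≤1 : (i j : Fin n) → occ i (var j) ≤ 1
occ-var≤1 i j with i ≟ j
... | yes _ = s≤s z≤n
... | no  _ = z≤n

occ-ext : {ρ : Fin m → Fin n} {k : Fin m} {k' : Fin n} →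
          (∀ i → occ k' (var (ρ i)) ≡ occ k (var i)) →
          ∀ i → occ (suc k') (var (ext ρ i)) ≡ occ (suc k) (var i)
occ-ext e zero    = refl
occ-ext {ρ = ρ} {k} {k'} e (suc i) = trans (occ-suc k' (ρ i)) (trans (e i) (sym (occ-suc k i)))

occ-rename : {ρ : Fin m → Fin n} {k : Fin m} {k' : Fin n} →
             (∀ i → occ k' (var (ρ i)) ≡ occ k (var i)) → ∀ t → occ k' (rename ρ t) ≡ occ k t
occ-rename e (var i)   = e i
occ-rename e (lam t)   = occ-rename (occ-ext e) t
occ-rename e (app t u) = cong₂ _+_ (occ-rename e t) (occ-rename e u)
occ-rename e (t [ u ]) = cong₂ _+_ (occ-rename (occ-ext e) t) (occ-rename e u)

LiftR-ext : {R : Fin m → Fin n → Set} {ρ : Fin m → Fin n} →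
            (∀ i → R i (ρ i)) → ∀ i → LiftR R i (ext ρ i)
LiftR-ext h zero    = here
LiftR-ext h (suc i) = there (h i)

RelT-rename : {R : Fin m → Fin n → Set} {ρ : Fin m → Fin n} →
              (∀ i → R i (ρ i)) → ∀ t → RelT R t (rename ρ t)
RelT-rename h (var i)   = var (h i)
RelT-rename h (lam t)   = lam (RelT-rename (LiftR-ext h) t)
RelT-rename h (app t u) = app (RelT-rename h t) (RelT-rename h u)
RelT-rename h (t [ u ]) = jmp (RelT-rename (LiftR-ext h) t) (RelT-rename h u)

-- Splitting the occurrences of x into x₀ and y below some binders; R relates every variable to
-- its admissible images, among them its images under ρ₀ (keep x) and ρ₁ (move x to y).
record SplitContext (m n : ℕ) : Set₁ where
  field
    R      : Fin m → Fin n → Set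
    x      : Fin m
    x₀ y   : Fin n
    ρ₀ ρ₁  : Fin m → Fin n
    R-ρ₀   : ∀ i → R i (ρ₀ i)
    R-ρ₁   : ∀ i → R i (ρ₁ i)
    occ-ρ₀ : ∀ i → occ x₀ (var (ρ₀ i)) ≡ occ x (var i)
    occ-ρ₁ : ∀ i → occ y  (var (ρ₁ i)) ≡ occ x (var i)

  Split : Term m → Set₁
  Split t = Σ (Term n) λ t' → RelT R t t' × (1 ≤ occ x₀ t') × (1 ≤ occ y t')

  occ-rename-ρ₀ : ∀ t → occ x₀ (rename ρ₀ t) ≡ occ x t
  occ-rename-ρ₀ = occ-rename occ-ρ₀

  occ-rename-ρ₁ : ∀ t → occ y (rename ρ₁ t) ≡ occ x t
  occ-rename-ρ₁ = occ-rename occ-ρ₁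

liftContext : SplitContext m n → SplitContext (suc m) (suc n)
liftContext C = record
  { R = LiftR R ; x = suc x ; x₀ = suc x₀ ; y = suc y ; ρ₀ = ext ρ₀ ; ρ₁ = ext ρ₁
  ; R-ρ₀ = LiftR-ext R-ρ₀ ; R-ρ₁ = LiftR-ext R-ρ₁
  ; occ-ρ₀ = occ-ext occ-ρ₀ ; occ-ρ₁ = occ-ext occ-ρ₁ }
  where open SplitContext C

module _ {m n m' n'} (C : SplitContext m n) (D : SplitContext m' n') where
  private
    module C = SplitContext C
    module D = SplitContext D

  splitPair : (t : Term m) (u : Term m') → 2 ≤ occ C.x t + occ D.x u →
              (2 ≤ occ C.x t → C.Split t) → (2 ≤ occ D.x u → D.Split u) →
              Σ (Term n) λ t' → Σ (Term n') λ u' → RelT C.R t t' × RelT D.R u u' ×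
                (1 ≤ occ C.x₀ t' + occ D.x₀ u') × (1 ≤ occ C.y t' + occ D.y u')
  splitPair t u h split-t split-u with occ C.x t in eq
  ... | 0 with split-u h
  ...   | u' , r , p , q = rename C.ρ₀ t , u' , RelT-rename C.R-ρ₀ t , r ,
                           ≤-trans p (m≤n+m _ _) , ≤-trans q (m≤n+m _ _)
  splitPair t u h split-t split-u | 1 =
    rename C.ρ₀ t , rename D.ρ₁ u , RelT-rename C.R-ρ₀ t , RelT-rename D.R-ρ₁ u ,
    ≤-trans (≤-reflexive (sym (trans (C.occ-rename-ρ₀ t) eq))) (m≤m+n _ _) ,
    ≤-trans (≤-trans (s≤s⁻¹ h) (≤-reflexive (sym (D.occ-rename-ρ₁ u)))) (m≤n+m _ _)
  splitPair t u h split-t split-u | suc (suc _) with split-t (s≤s (s≤s z≤n))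
  ... | t' , r , p , q = t' , rename D.ρ₀ u , r , RelT-rename D.R-ρ₀ u ,
                         ≤-trans p (m≤m+n _ _) , ≤-trans q (m≤m+n _ _)

split : (C : SplitContext m n) (t : Term m) → 2 ≤ occ (SplitContext.x C) t → SplitContext.Split C t
split C (var j) h = ⊥-elim (1+n≰n (≤-trans h (occ-var≤1 _ j)))
split C (lam t) h with split (liftContext C) t h
... | t' , r , p , q = lam t' , lam r , p , q
split C (app t u) h with splitPair C C t u h (split C t) (split C u)
... | t' , u' , r , r' , p , q = app t' u' , app r r' , p , q
split C (t [ u ]) h with splitPair (liftContext C) C t u h (split (liftContext C) t) (split C u)
... | t' , u' , r , r' , p , q = t' [ u' ] , jmp r r' , p , q

splitting : SplitContext (suc n) (suc (suc n))
splitting = record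
  { R = SplitVar ; x = zero ; x₀ = zero ; y = suc zero ; ρ₀ = ext suc ; ρ₁ = suc
  ; R-ρ₀ = λ { zero → keep ; (suc k) → other k }
  ; R-ρ₁ = λ { zero → move ; (suc k) → other k }
  ; occ-ρ₀ = λ { zero → refl ; (suc k) → refl }
  ; occ-ρ₁ = λ { zero → refl ; (suc k) → refl } }

IsSplit-exists : (t : Term (suc n)) → 2 ≤ occ zero t → ∃ (IsSplit t)
IsSplit-exists = split splitting

jump-reducible : (t : Term (suc n)) (u : Term n) → ∃ ((t [ u ]) ⟶_)
jump-reducible t u with occ zero t in eq
... | 0           = _ , root (w eq)
... | 1           = _ , root (d eq)
... | suc (suc _) =
  let 1<occ = subst≡ (1 <_) (sym eq) (s≤s (s≤s z≤n))
      (t' , split) = IsSplit-exists t 1<occ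
  in  _ , root (c t' 1<occ split)

progress : (t : Term n) → JumpFree t ⊎ ∃ (t ⟶_)
progress (var i) = inj₁ (var i)
progress (lam t) with progress t
... | inj₁ jt      = inj₁ (lam jt)
... | inj₂ (s , r) = inj₂ (lam s , lamC r)
progress (app t u) with progress t | progress u
... | inj₂ (s , r) | _            = inj₂ (app s u , appL r)
... | inj₁ _       | inj₂ (s , r) = inj₂ (app t s , appR r)
... | inj₁ jt      | inj₁ ju      = inj₁ (app jt ju)
progress (t [ u ]) = inj₂ (jump-reducible t u)

Normal⇒JumpFree : (t : Term n) → Normal t → JumpFree t
Normal⇒JumpFree t nf with progress t
... | inj₁ jt      = jt
... | inj₂ (s , r) = ⊥-elim (nf s r)

-- Termination

-- weight f t counts the free occurrences of each i in t with weight f i, multiplied by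
-- 3 ^ weight₀ s for every jump s [ v ] whose argument v contains the occurrence.
weight  : (Fin n → ℕ) → Term n → ℕ
weight₀ : Term (suc n) → ℕ

weight f (var i)   = f i
weight f (lam t)   = weight (0 ∷ f) t
weight f (app t u) = weight f t + weight f u
weight f (t [ u ]) = weight (0 ∷ f) t + 3 ^ weight₀ t * weight f u

weight₀ = weight (1 ∷ λ _ → 0)

weight₁ : Term (suc (suc n)) → ℕ
weight₁ = weight (0 ∷ 1 ∷ λ _ → 0)

weight-cong : {f g : Fin n → ℕ} → (∀ i → f i ≡ g i) → ∀ t → weight f t ≡ weight g t
weight-cong e (var i)   = e i
weight-cong e (lam t)   = weight-cong (λ { zero → refl ; (suc i) → e i }) t
weight-cong e (app t u) = cong₂ _+_ (weight-cong e t) (weight-cong e u)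
weight-cong e (t [ u ]) =
  cong₂ (λ v w → v + 3 ^ weight₀ t * w)
        (weight-cong (λ { zero → refl ; (suc i) → e i }) t) (weight-cong e u)

weight-zero : {f : Fin n → ℕ} → (∀ i → f i ≡ 0) → ∀ t → weight f t ≡ 0
weight-zero e (var i)   = e i
weight-zero e (lam t)   = weight-zero (λ { zero → refl ; (suc i) → e i }) t
weight-zero e (app t u) = cong₂ _+_ (weight-zero e t) (weight-zero e u)
weight-zero e (t [ u ]) =
  cong₂ _+_ (weight-zero (λ { zero → refl ; (suc i) → e i }) t)
            (trans (cong (3 ^ weight₀ t *_) (weight-zero e u)) (*-zeroʳ (3 ^ weight₀ t)))

∷-linear : (f g : Fin n → ℕ) (a : ℕ) →
           ∀ i → (0 ∷ λ i → f i + a * g i) i ≡ (0 ∷ f) i + a * (0 ∷ g) i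
∷-linear f g a zero    = sym (*-zeroʳ a)
∷-linear f g a (suc i) = refl

weight-linear : (f g : Fin n → ℕ) (a : ℕ) (t : Term n) →
                weight (λ i → f i + a * g i) t ≡ weight f t + a * weight g t
weight-linear f g a (var i)   = refl
weight-linear f g a (lam t)   =
  trans (weight-cong (∷-linear f g a) t) (weight-linear (0 ∷ f) (0 ∷ g) a t)
weight-linear f g a (app t u) =
  trans (cong₂ _+_ (weight-linear f g a t) (weight-linear f g a u))
        (regroup (weight f t) (weight g t) (weight f u) (weight g u) a)
  where
  regroup : ∀ p q p' q' a → (p + a * q) + (p' + a * q') ≡ (p + p') + a * (q + q')
  regroup = solve-∀
weight-linear f g a (t [ u ]) =
  trans (cong₂ (λ v w → v + 3 ^ weight₀ t * w)
               (trans (weight-cong (∷-linear f g a) t) (weight-linear (0 ∷ f) (0 ∷ g) a t))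
               (weight-linear f g a u))
        (regroup (weight (0 ∷ f) t) (weight (0 ∷ g) t) (weight f u) (weight g u) a (3 ^ weight₀ t))
  where
  regroup : ∀ p q p' q' a h → (p + a * q) + h * (p' + a * q') ≡ (p + h * p') + a * (q + h * q')
  regroup = solve-∀

∷-ext : (a : ℕ) (f : Fin n → ℕ) (ρ : Fin m → Fin n) → ∀ i → (a ∷ f) (ext ρ i) ≡ (a ∷ f ∘ ρ) i
∷-ext a f ρ zero    = refl
∷-ext a f ρ (suc i) = refl

weight-rename  : (f : Fin n → ℕ) (ρ : Fin m → Fin n) (t : Term m) →
                 weight f (rename ρ t) ≡ weight (f ∘ ρ) t
weight₀-rename : (ρ : Fin m → Fin n) (t : Term (suc m)) → weight₀ (rename (ext ρ) t) ≡ weight₀ t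

weight-rename f ρ (var i)   = refl
weight-rename f ρ (lam t)   = trans (weight-rename (0 ∷ f) (ext ρ) t) (weight-cong (∷-ext 0 f ρ) t)
weight-rename f ρ (app t u) = cong₂ _+_ (weight-rename f ρ t) (weight-rename f ρ u)
weight-rename f ρ (t [ u ]) =
  cong₂ _+_ (trans (weight-rename (0 ∷ f) (ext ρ) t) (weight-cong (∷-ext 0 f ρ) t))
            (cong₂ (λ v w → 3 ^ v * w) (weight₀-rename ρ t) (weight-rename f ρ u))

weight₀-rename ρ t = trans (weight-rename _ (ext ρ) t) (weight-cong (∷-ext 1 _ ρ) t)

∷-exts : (a : ℕ) (f : Fin n → ℕ) (σ : Fin m → Term n) →
         ∀ i → weight (a ∷ f) (exts σ i) ≡ (a ∷ λ i → weight f (σ i)) i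
∷-exts a f σ zero    = refl
∷-exts a f σ (suc i) = weight-rename (a ∷ f) suc (σ i)

weight-subst  : (f : Fin n → ℕ) (σ : Fin m → Term n) (t : Term m) →
                weight f (subst σ t) ≡ weight (λ i → weight f (σ i)) t
weight₀-subst : (σ : Fin m → Term n) (t : Term (suc m)) → weight₀ (subst (exts σ) t) ≡ weight₀ t

weight-subst f σ (var i)   = refl
weight-subst f σ (lam t)   = trans (weight-subst (0 ∷ f) (exts σ) t) (weight-cong (∷-exts 0 f σ) t)
weight-subst f σ (app t u) = cong₂ _+_ (weight-subst f σ t) (weight-subst f σ u)
weight-subst f σ (t [ u ]) =
  cong₂ _+_ (trans (weight-subst (0 ∷ f) (exts σ) t) (weight-cong (∷-exts 0 f σ) t))
            (cong₂ (λ v w → 3 ^ v * w) (weight₀-subst σ t) (weight-subst f σ u))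

weight₀-subst σ t =
  trans (weight-subst _ (exts σ) t)
        (weight-cong (λ i → trans (∷-exts 1 _ σ i) (vanish i)) t)
  where
  vanish : ∀ i → (1 ∷ λ i → weight (λ _ → 0) (σ i)) i ≡ (1 ∷ λ _ → 0) i
  vanish zero    = refl
  vanish (suc i) = weight-zero (λ _ → refl) (σ i)

weight-⟨⟩ : (f : Fin n → ℕ) (t : Term (suc n)) (u : Term n) →
            weight f (t ⟨ u ⟩) ≡ weight (weight f u ∷ f) t
weight-⟨⟩ f t u = trans (weight-subst f (sub0 u) t) (weight-cong (λ { zero → refl ; (suc i) → refl }) t)

weight-∷ : (a : ℕ) (f : Fin n → ℕ) (t : Term (suc n)) →
           weight (a ∷ f) t ≡ weight (0 ∷ f) t + a * weight₀ t
weight-∷ a f t = trans (weight-cong split-head t) (weight-linear (0 ∷ f) (1 ∷ λ _ → 0) a t)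
  where
  split-head : ∀ i → (a ∷ f) i ≡ (0 ∷ f) i + a * (1 ∷ λ _ → 0) i
  split-head zero    = sym (*-identityʳ a)
  split-head (suc i) = sym (trans (cong (f i +_) (*-zeroʳ a)) (+-identityʳ (f i)))

occ≤weight     : (k : Fin n) (t : Term n) → occ k t ≤ weight (λ j → occ k (var j)) t
occ-suc≤weight : (k : Fin n) (t : Term (suc n)) → occ (suc k) t ≤ weight (0 ∷ λ j → occ k (var j)) t

occ≤weight k (var j)   = ≤-refl
occ≤weight k (lam t)   = occ-suc≤weight k t
occ≤weight k (app t u) = +-mono-≤ (occ≤weight k t) (occ≤weight k u)
occ≤weight k (t [ u ]) =
  +-mono-≤ (occ-suc≤weight k t)
           (≤-trans (occ≤weight k u) (m≤n*m _ (3 ^ weight₀ t) {{m^n≢0 3 (weight₀ t)}}))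

occ-suc≤weight k t =
  ≤-trans (occ≤weight (suc k) t) (≤-reflexive (weight-cong (λ { zero → refl ; (suc j) → occ-suc k j }) t))

μ : Term n → ℕ
μ (var i)   = 0
μ (lam t)   = μ t
μ (app t u) = μ t + μ u
μ (t [ u ]) = μ t + 3 ^ weight₀ t * suc (μ u)

μ-rename : (ρ : Fin m → Fin n) (t : Term m) → μ (rename ρ t) ≡ μ t
μ-rename ρ (var i)   = refl
μ-rename ρ (lam t)   = μ-rename (ext ρ) t
μ-rename ρ (app t u) = cong₂ _+_ (μ-rename ρ t) (μ-rename ρ u)
μ-rename ρ (t [ u ]) =
  cong₂ _+_ (μ-rename (ext ρ) t) (cong₂ (λ v w → 3 ^ v * suc w) (weight₀-rename ρ t) (μ-rename ρ u))

μ-exts : (σ : Fin m → Term n) → ∀ i → μ (exts σ i) ≡ (0 ∷ μ ∘ σ) i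
μ-exts σ zero    = refl
μ-exts σ (suc i) = μ-rename suc (σ i)

μ-subst : (σ : Fin m → Term n) (t : Term m) → μ (subst σ t) ≡ μ t + weight (μ ∘ σ) t
μ-subst σ (var i)   = refl
μ-subst σ (lam t)   = trans (μ-subst (exts σ) t) (cong (μ t +_) (weight-cong (μ-exts σ) t))
μ-subst σ (app t u) =
  trans (cong₂ _+_ (μ-subst σ t) (μ-subst σ u))
        (regroup (μ t) (weight (μ ∘ σ) t) (μ u) (weight (μ ∘ σ) u))
  where
  regroup : ∀ p q p' q' → (p + q) + (p' + q') ≡ (p + p') + (q + q')
  regroup = solve-∀
μ-subst σ (t [ u ]) = begin
  μ (subst (exts σ) t) + 3 ^ weight₀ (subst (exts σ) t) * suc (μ (subst σ u))
    ≡⟨ cong (_+ 3 ^ weight₀ (subst (exts σ) t) * suc (μ (subst σ u)))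
            (trans (μ-subst (exts σ) t) (cong (μ t +_) (weight-cong (μ-exts σ) t))) ⟩
  (μ t + weight (0 ∷ μ ∘ σ) t) + 3 ^ weight₀ (subst (exts σ) t) * suc (μ (subst σ u))
    ≡⟨ cong₂ (λ v w → (μ t + weight (0 ∷ μ ∘ σ) t) + 3 ^ v * suc w) (weight₀-subst σ t) (μ-subst σ u) ⟩
  (μ t + weight (0 ∷ μ ∘ σ) t) + 3 ^ weight₀ t * suc (μ u + weight (μ ∘ σ) u)
    ≡⟨ regroup (μ t) (weight (0 ∷ μ ∘ σ) t) (μ u) (weight (μ ∘ σ) u) (3 ^ weight₀ t) ⟩
  (μ t + 3 ^ weight₀ t * suc (μ u)) + (weight (0 ∷ μ ∘ σ) t + 3 ^ weight₀ t * weight (μ ∘ σ) u)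
    ∎
  where
  open ≡-Reasoning
  regroup : ∀ p q p' q' h → (p + q) + h * suc (p' + q') ≡ (p + h * suc p') + (q + h * q')
  regroup = solve-∀

μ-⟨⟩ : (t : Term (suc n)) (u : Term n) → μ (t ⟨ u ⟩) ≡ μ t + μ u * weight₀ t
μ-⟨⟩ t u = begin
  μ (t ⟨ u ⟩)
    ≡⟨ μ-subst (sub0 u) t ⟩
  μ t + weight (μ ∘ sub0 u) t
    ≡⟨ cong (μ t +_) (weight-cong (λ { zero → refl ; (suc i) → refl }) t) ⟩
  μ t + weight (μ u ∷ λ _ → 0) t
    ≡⟨ cong (μ t +_) (weight-∷ (μ u) _ t) ⟩
  μ t + (weight (0 ∷ λ _ → 0) t + μ u * weight₀ t)
    ≡⟨ cong (λ v → μ t + (v + μ u * weight₀ t)) (weight-zero (λ { zero → refl ; (suc i) → refl }) t) ⟩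
  μ t + μ u * weight₀ t
    ∎
  where open ≡-Reasoning

n≤3^n : ∀ n → n ≤ 3 ^ n
n≤3^n zero    = z≤n
n≤3^n (suc n) = begin
  suc n                        ≤⟨ +-mono-≤ (m^n>0 3 n) (n≤3^n n) ⟩
  3 ^ n + 3 ^ n                ≤⟨ +-monoʳ-≤ (3 ^ n) (m≤m+n (3 ^ n) (3 ^ n + 0)) ⟩
  3 ^ n + (3 ^ n + (3 ^ n + 0)) ∎
  where open ≤-Reasoning

m*n≤3^n*m : ∀ m n → m * n ≤ 3 ^ n * m
m*n≤3^n*m m n = ≤-trans (≤-reflexive (*-comm m n)) (*-monoˡ-≤ m (n≤3^n n))

3^-superadditive : ∀ {m n} → 1 ≤ m → 1 ≤ n → 3 ^ m + 3 ^ n < 3 ^ (m + n)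
3^-superadditive {suc m} {suc n} _ _ = begin-strict
  3 ^ suc m + 3 ^ suc n     ≤⟨ +-mono-≤ (^-monoʳ-≤ 3 1+m≤) (^-monoʳ-≤ 3 (m≤n+m (suc n) m)) ⟩
  N + N                     <⟨ +-monoʳ-< N (m<m+n N (≤-trans (m^n>0 3 (m + suc n)) (m≤m+n N 0))) ⟩
  N + (N + (N + 0))         ∎
  where
  open ≤-Reasoning
  N = 3 ^ (m + suc n)
  1+m≤ : suc m ≤ m + suc n
  1+m≤ = ≤-trans (s≤s (m≤m+n m n)) (≤-reflexive (sym (+-suc m n)))

infix 4 _≺_

-- The weights must not grow either, because μ of an enclosing jump depends on weight₀.
record _≺_ (s t : Term n) : Set where
  field
    μ-<      : μ s < μ t
    weight-≤ : ∀ f → weight f s ≤ weight f t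
open _≺_

⟨⟩≺[] : (t : Term (suc n)) (u : Term n) → t ⟨ u ⟩ ≺ t [ u ]
⟨⟩≺[] t u .μ-< = begin-strict
  μ (t ⟨ u ⟩)
    ≡⟨ μ-⟨⟩ t u ⟩
  μ t + μ u * weight₀ t
    ≤⟨ +-monoʳ-≤ (μ t) (m*n≤3^n*m (μ u) (weight₀ t)) ⟩
  μ t + 3 ^ weight₀ t * μ u
    <⟨ +-monoʳ-< (μ t) (*-monoʳ-< (3 ^ weight₀ t) {{m^n≢0 3 (weight₀ t)}} (n<1+n (μ u))) ⟩
  μ t + 3 ^ weight₀ t * suc (μ u)
    ∎
  where open ≤-Reasoning
⟨⟩≺[] t u .weight-≤ f = begin
  weight f (t ⟨ u ⟩)                              ≡⟨ weight-⟨⟩ f t u ⟩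
  weight (weight f u ∷ f) t                       ≡⟨ weight-∷ (weight f u) f t ⟩
  weight (0 ∷ f) t + weight f u * weight₀ t       ≤⟨ +-monoʳ-≤ _ (m*n≤3^n*m (weight f u) (weight₀ t)) ⟩
  weight (0 ∷ f) t + 3 ^ weight₀ t * weight f u   ∎
  where open ≤-Reasoning

weight₀-[weaken] : (s : Term (suc (suc n))) (u : Term n) → weight₀ (s [ weaken u ]) ≡ weight₁ s
weight₀-[weaken] s u = begin
  weight₁ s + 3 ^ weight₀ s * weight (1 ∷ λ _ → 0) (weaken u)
    ≡⟨ cong (λ v → weight₁ s + 3 ^ weight₀ s * v)
            (trans (weight-rename _ suc u) (weight-zero (λ _ → refl) u)) ⟩
  weight₁ s + 3 ^ weight₀ s * 0
    ≡⟨ cong (weight₁ s +_) (*-zeroʳ (3 ^ weight₀ s)) ⟩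
  weight₁ s + 0
    ≡⟨ +-identityʳ (weight₁ s) ⟩
  weight₁ s
    ∎
  where open ≡-Reasoning

weight₀-merge₀₁ : (s : Term (suc (suc n))) → weight₀ (rename merge₀₁ s) ≡ weight₀ s + weight₁ s
weight₀-merge₀₁ s = begin
  weight₀ (rename merge₀₁ s)         ≡⟨ weight-rename _ merge₀₁ s ⟩
  weight ((1 ∷ λ _ → 0) ∘ merge₀₁) s ≡⟨ weight-cong (λ { zero → refl ; (suc zero) → refl
                                                      ; (suc (suc i)) → refl }) s ⟩
  weight (1 ∷ 1 ∷ λ _ → 0) s         ≡⟨ weight-∷ 1 _ s ⟩
  weight₁ s + 1 * weight₀ s          ≡⟨ cong (weight₁ s +_) (*-identityˡ (weight₀ s)) ⟩
  weight₁ s + weight₀ s              ≡⟨ +-comm (weight₁ s) (weight₀ s) ⟩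
  weight₀ s + weight₁ s              ∎
  where open ≡-Reasoning

weight-merge₀₁ : (f : Fin n → ℕ) (s : Term (suc (suc n))) →
                 weight (0 ∷ f) (rename merge₀₁ s) ≡ weight (0 ∷ 0 ∷ f) s
weight-merge₀₁ f s = trans (weight-rename (0 ∷ f) merge₀₁ s)
                           (weight-cong (λ { zero → refl ; (suc zero) → refl ; (suc (suc i)) → refl }) s)

+-*-regroup : ∀ x y p q → (x + p * y) + q * y ≡ x + (p + q) * y
+-*-regroup = solve-∀

contraction≺ : (s : Term (suc (suc n))) (u : Term n) → 1 ≤ weight₀ s → 1 ≤ weight₁ s →
               (s [ weaken u ]) [ u ] ≺ rename merge₀₁ s [ u ]
contraction≺ s u A≥1 B≥1 .μ-< = begin-strict
  (μ s + 3 ^ A * suc (μ (weaken u))) + 3 ^ weight₀ (s [ weaken u ]) * suc (μ u)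
    ≡⟨ cong₂ (λ v w → (μ s + 3 ^ A * suc v) + 3 ^ w * suc (μ u))
             (μ-rename suc u) (weight₀-[weaken] s u) ⟩
  (μ s + 3 ^ A * suc (μ u)) + 3 ^ B * suc (μ u)
    ≡⟨ +-*-regroup (μ s) (suc (μ u)) (3 ^ A) (3 ^ B) ⟩
  μ s + (3 ^ A + 3 ^ B) * suc (μ u)
    <⟨ +-monoʳ-< (μ s) (*-monoˡ-< (suc (μ u)) (3^-superadditive A≥1 B≥1)) ⟩
  μ s + 3 ^ (A + B) * suc (μ u)
    ≡⟨ cong₂ (λ v w → v + 3 ^ w * suc (μ u)) (μ-rename merge₀₁ s) (weight₀-merge₀₁ s) ⟨
  μ (rename merge₀₁ s [ u ])
    ∎
  where
  open ≤-Reasoning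
  A = weight₀ s
  B = weight₁ s
contraction≺ s u A≥1 B≥1 .weight-≤ f = begin
  (weight (0 ∷ 0 ∷ f) s + 3 ^ A * weight (0 ∷ f) (weaken u)) + 3 ^ weight₀ (s [ weaken u ]) * weight f u
    ≡⟨ cong₂ (λ v w → (weight (0 ∷ 0 ∷ f) s + 3 ^ A * v) + 3 ^ w * weight f u)
             (weight-rename (0 ∷ f) suc u) (weight₀-[weaken] s u) ⟩
  (weight (0 ∷ 0 ∷ f) s + 3 ^ A * weight f u) + 3 ^ B * weight f u
    ≡⟨ +-*-regroup (weight (0 ∷ 0 ∷ f) s) (weight f u) (3 ^ A) (3 ^ B) ⟩
  weight (0 ∷ 0 ∷ f) s + (3 ^ A + 3 ^ B) * weight f u
    ≤⟨ +-monoʳ-≤ _ (*-monoˡ-≤ (weight f u) (<⇒≤ (3^-superadditive A≥1 B≥1))) ⟩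
  weight (0 ∷ 0 ∷ f) s + 3 ^ (A + B) * weight f u
    ≡⟨ cong₂ (λ v w → v + 3 ^ w * weight f u) (weight-merge₀₁ f s) (weight₀-merge₀₁ s) ⟨
  weight f (rename merge₀₁ s [ u ])
    ∎
  where
  open ≤-Reasoning
  A = weight₀ s
  B = weight₁ s

occ₀≤weight₀ : (t : Term (suc n)) → occ zero t ≤ weight₀ t
occ₀≤weight₀ t =
  ≤-trans (occ≤weight zero t) (≤-reflexive (weight-cong (λ { zero → refl ; (suc j) → refl }) t))

occ₁≤weight₁ : (t : Term (suc (suc n))) → occ (suc zero) t ≤ weight₁ t
occ₁≤weight₁ t =
  ≤-trans (occ≤weight (suc zero) t)
          (≤-reflexive (weight-cong (λ { zero → refl ; (suc zero) → refl ; (suc (suc j)) → refl }) t))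

split≺ : {t : Term (suc n)} {t' : Term (suc (suc n))} (u : Term n) → IsSplit t t' →
         (t' [ weaken u ]) [ u ] ≺ t [ u ]
split≺ {t' = t'} u split@(_ , occ₀≥1 , occ₁≥1) with IsSplit⇒≡rename split
... | refl = contraction≺ t' u (≤-trans occ₀≥1 (occ₀≤weight₀ t')) (≤-trans occ₁≥1 (occ₁≤weight₁ t'))

⟶⇒≺ : {t s : Term n} → t ⟶ s → s ≺ t
⟶⇒≺ (root (w {t} {u} _))        = ⟨⟩≺[] t u
⟶⇒≺ (root (d {t} {u} _))        = ⟨⟩≺[] t u
⟶⇒≺ (root (c {u = u} _ _ split)) = split≺ u split
⟶⇒≺ (lamC r) .μ-<        = ⟶⇒≺ r .μ-<
⟶⇒≺ (lamC r) .weight-≤ f = ⟶⇒≺ r .weight-≤ (0 ∷ f)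
⟶⇒≺ (appL {u = u} r) .μ-<        = +-monoˡ-< (μ u) (⟶⇒≺ r .μ-<)
⟶⇒≺ (appL {u = u} r) .weight-≤ f = +-monoˡ-≤ (weight f u) (⟶⇒≺ r .weight-≤ f)
⟶⇒≺ (appR {u = u} r) .μ-<        = +-monoʳ-< (μ u) (⟶⇒≺ r .μ-<)
⟶⇒≺ (appR {u = u} r) .weight-≤ f = +-monoʳ-≤ (weight f u) (⟶⇒≺ r .weight-≤ f)
⟶⇒≺ (jmpL {u = u} r) .μ-<        =
  +-mono-<-≤ (⟶⇒≺ r .μ-<) (*-monoˡ-≤ (suc (μ u)) (^-monoʳ-≤ 3 (⟶⇒≺ r .weight-≤ (1 ∷ λ _ → 0))))
⟶⇒≺ (jmpL {u = u} r) .weight-≤ f =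
  +-mono-≤ (⟶⇒≺ r .weight-≤ (0 ∷ f)) (*-monoˡ-≤ (weight f u) (^-monoʳ-≤ 3 (⟶⇒≺ r .weight-≤ (1 ∷ λ _ → 0))))
⟶⇒≺ (jmpR {u = t} r) .μ-<        =
  +-monoʳ-< (μ t) (*-monoʳ-< (3 ^ weight₀ t) {{m^n≢0 3 (weight₀ t)}} (s≤s (⟶⇒≺ r .μ-<)))
⟶⇒≺ (jmpR {u = t} r) .weight-≤ f =
  +-monoʳ-≤ (weight (0 ∷ f) t) (*-monoʳ-≤ (3 ^ weight₀ t) (⟶⇒≺ r .weight-≤ f))

⟶-wellFounded : WellFounded (flip (_⟶_ {n}))
⟶-wellFounded = Subrelation.wellFounded (λ r → ⟶⇒≺ r .μ-<) (On.wellFounded μ <-wellFounded)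

-- Normal forms

normaliseAcc : {t : Term n} → Acc (flip _⟶_) t → ∃ λ s → t ⟶* s × JumpFree s
normaliseAcc {t = t} (acc rec) with progress t
... | inj₁ jt = t , ε , jt
... | inj₂ (s , r) with normaliseAcc (rec r)
...   | v , rs , jv = v , r ◅ rs , jv

⟶*-jnf : (t : Term n) → t ⟶* jnf t
⟶*-jnf t with normaliseAcc (⟶-wellFounded t)
... | s , rs , js = subst≡ (t ⟶*_) (sym (trans (jnf-⟶* rs) (jnf-JumpFree js))) rs

reduct-⟶*-jnf : {t u : Term n} → t ⟶* u → u ⟶* jnf t
reduct-⟶*-jnf {u = u} rs = subst≡ (u ⟶*_) (sym (jnf-⟶* rs)) (⟶*-jnf u)

IsNF-jnf : (t : Term n) → IsNF t (jnf t)
IsNF-jnf t = ⟶*-jnf t , JumpFree⇒Normal (JumpFree-jnf t)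

IsNF⇒≡jnf : {t s : Term n} → IsNF t s → s ≡ jnf t
IsNF⇒≡jnf {s = s} (rs , nf) = trans (sym (jnf-JumpFree (Normal⇒JumpFree s nf))) (sym (jnf-⟶* rs))

≡jnf⇒IsNF : {t s : Term n} → s ≡ jnf t → IsNF t s
≡jnf⇒IsNF {t = t} refl = IsNF-jnf t

lemma2p10 :
    (∀ {n} {t u₁ u₂ : Term n} → t ⟶* u₁ → t ⟶* u₂ → ∃ λ s → (u₁ ⟶* s) × (u₂ ⟶* s))
    × (∀ {n} → WellFounded (λ (s t : Term n) → t ⟶ s))
    × (∀ {n} {t s₁ s₂ : Term n} → IsNF t s₁ → IsNF t s₂ → s₁ ≡ s₂)
    × (∀ {n} (i : Fin n) → IsNF (var i) (var i))
    × (∀ {n} {u s : Term (suc n)} → IsNF u s → IsNF (lam u) (lam s))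
    × (∀ {n} {u v s r : Term n} → IsNF u s → IsNF v r → IsNF (app u v) (app s r))
    × (∀ {n} {u : Term (suc n)} {v : Term n} {s : Term (suc n)} {r : Term n} →
         IsNF u s → IsNF v r → IsNF (u [ v ]) (s ⟨ r ⟩))
lemma2p10 =
    (λ {_} {t} r₁ r₂ → jnf t , reduct-⟶*-jnf r₁ , reduct-⟶*-jnf r₂)
  , ⟶-wellFounded
  , (λ p q → trans (IsNF⇒≡jnf p) (sym (IsNF⇒≡jnf q)))
  , (λ i → IsNF-jnf (var i))
  , (λ p → ≡jnf⇒IsNF (cong lam (IsNF⇒≡jnf p)))
  , (λ p q → ≡jnf⇒IsNF (cong₂ app (IsNF⇒≡jnf p) (IsNF⇒≡jnf q)))
  , (λ p q → ≡jnf⇒IsNF (cong₂ _⟨_⟩ (IsNF⇒≡jnf p) (IsNF⇒≡jnf q)))
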